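{- Every graph $H$ is the $\gamma_t^L$-graph of infinitely many graphs; that is, for every graph $H$ there exist infinitely many graphs $G$ whose $\gamma_t^L$-graph is isomorphic to $H$.
   Context: For a graph $G$, a set $S\subseteq V(G)$ is locating-dominating if it is dominating and the sets $N[v]\cap S$, for $v\in V(G)-S$, are pairwise distinct. $S$ is a locating-total dominating set if it is locating-dominating and every vertex of $V(G)$ is adjacent to some vertex of $S$. $\gamma_t^L(G)$ is the minimum cardinality of a locating-total dominating set. The $\gamma_t^L$-graph of $G$ has one vertex for each locating-total dominating set of cardinality $\gamma_t^L(G)$, and the vertices corresponding to $S_u,S_w$ are adjacent iff there exist $u'\in S_u$, $w'\in S_w$ with $u'w'\in E(G)$ and $S_w=(S_u-\{u'\})\cup\{w'\}$. -}

module Defs where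

open import Data.Bool using (Bool; true; false)
open import Data.Nat using (ℕ; _≤_)
open import Data.Fin using (Fin)
open import Data.Fin.Subset using (Subset; _∈_; _∉_; _∪_; _-_; ⁅_⁆; ∣_∣)
open import Data.Product using (Σ; ∃; ∃-syntax; _×_)
open import Data.Sum using (_⊎_)
open import Function.Bundles using (_⇔_)
open import Relation.Binary.PropositionalEquality using (_≡_)

record Graph : Set where
  field
    n      : ℕ
    adj    : Fin n → Fin n → Bool
    sym    : ∀ u v → adj u v ≡ adj v u
    irrefl : ∀ v → adj v v ≡ false

module _ (G : Graph) where
  open Graph G

  Adj : Fin n → Fin n → Set
  Adj u v = adj u v ≡ true

  InClosedNbhd : Fin n → Fin n → Set
  InClosedNbhd v w = (v ≡ w) ⊎ Adj v w

  Dominating : Subset n → Set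
  Dominating S = ∀ v → v ∉ S → ∃[ w ] (w ∈ S × Adj v w)

  SameTrace : Subset n → Fin n → Fin n → Set
  SameTrace S u v = ∀ w → ((w ∈ S × InClosedNbhd u w) ⇔ (w ∈ S × InClosedNbhd v w))

  Locating : Subset n → Set
  Locating S = ∀ u v → u ∉ S → v ∉ S → SameTrace S u v → u ≡ v

  LocatingDominating : Subset n → Set
  LocatingDominating S = Dominating S × Locating S

  Total : Subset n → Set
  Total S = ∀ v → ∃[ w ] (w ∈ S × Adj v w)

  LocatingTotalDominating : Subset n → Set
  LocatingTotalDominating S = LocatingDominating S × Total S

  MinLTD : Subset n → Set
  MinLTD S = LocatingTotalDominating S
           × (∀ T → LocatingTotalDominating T → ∣ S ∣ ≤ ∣ T ∣)

  GammaAdj : Subset n → Subset n → Set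
  GammaAdj Su Sw = ∃[ u' ] ∃[ w' ]
    (u' ∈ Su × w' ∈ Sw × Adj u' w' × Sw ≡ (Su - u') ∪ ⁅ w' ⁆)

-- The γ_t^L-graph of G is isomorphic to H: a bijection f from V(H) onto the
-- set of minimum locating-total dominating sets of G preserving adjacency both ways.
IsGammaGraphOf : Graph → Graph → Set
IsGammaGraphOf H G =
  Σ (Fin (Graph.n H) → Subset (Graph.n G)) λ f →
      (∀ i → MinLTD G (f i))
    × (∀ S → MinLTD G S → ∃[ i ] (f i ≡ S))
    × (∀ i j → f i ≡ f j → i ≡ j)
    × (∀ i j → Adj H i j ⇔ GammaAdj G (f i) (f j))

module Submission where

-- Given H and a bound N,
-- build G from a hub vertex z, a copy x₁,…,x_k of H (each xᵢ adjacent to z),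
-- and k + N disjoint paths ℓ–s–s'–ℓ', where the i-th path is attached to xᵢ
-- through both of its inner vertices s and s'.  Every total dominating set
-- must contain all inner path vertices (they are the only neighbours of the
-- leaves ℓ, ℓ'), call this set F, and some xⱼ (the only neighbours of z).
-- Conversely each F ∪ {xᵢ} is locating-total dominating, so the minimum ones
-- are exactly the sets F ∪ {xᵢ}, and two of them differ by one exchange
-- xᵢ ↦ xⱼ, which is a γ_t^L-move exactly when xᵢxⱼ is an edge, i.e. ij ∈ E(H).
--
-- The padding paths make G as large as required.

open import Defs
open import Data.Bool using (Bool; true; false; _∨_)
open import Data.Bool.Properties using (∨-comm; ∨-identityʳ; ∨-idem)
open import Data.Empty using (⊥-elim)
open import Data.Fin using (Fin; zero; suc; _↑ˡ_; _↑ʳ_; splitAt; join; combine; remQuot)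
open import Data.Fin.Properties
  using (↑ˡ-injective; splitAt-↑ˡ; splitAt-↑ʳ; join-splitAt; remQuot-combine; combine-remQuot)
open import Data.Fin.Subset using (Subset; _∈_; _∉_; _∪_; _-_; ⁅_⁆; ∣_∣; _⊆_)
open import Data.Fin.Subset.Properties
  using ( x∈p∪q⁻; x∈p∪q⁺; p⊆p∪q; ∪-identityʳ; x∈⁅y⁆⇒x≡y; x∈⁅x⁆; ⊆-antisym
        ; p⊆q⇒∣p∣≤∣q∣; p⊂q⇒∣p∣<∣q∣; _∈?_; p─q⊆p; x∈p∧x≢y⇒x∈p-y )
open import Data.Nat using (ℕ; suc; _≤_; _+_; _*_)
open import Data.Nat.Properties using (<⇒≱; m≤n+m; m≤n*m; n≤1+n; module ≤-Reasoning)
open import Data.Product using (∃-syntax; _×_; _,_; proj₁; proj₂)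
open import Data.Sum using (_⊎_; inj₁; inj₂)
import Data.Sum as Sum
open import Data.Vec using (_∷_; here; there; tabulate; lookup)
open import Data.Vec.Properties using ([]=⇒lookup; lookup⇒[]=; lookup∘tabulate)
open import Function using (_∘_)
open import Function.Bundles using (_⇔_; mk⇔; Equivalence)
open import Relation.Nullary using (¬_; yes; no)
open import Relation.Binary.PropositionalEquality
  using (_≡_; _≢_; refl; sym; trans; cong; cong₂; subst; module ≡-Reasoning)

open Equivalence using (to; from)

x∉p-x : ∀ {n} (p : Subset n) (x : Fin n) → x ∉ p - x
x∉p-x (b ∷ p) zero    ()
x∉p-x (b ∷ p) (suc x) (there h) = x∉p-x p x h

∈-minus : ∀ {n} {p : Subset n} {x y : Fin n} → x ∈ p - y → x ∈ p × x ≢ y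
∈-minus {p = p} {x} h = p─q⊆p p _ h , λ { refl → x∉p-x p x h }

∣p∪⁅x⁆∣ : ∀ {n} (p : Subset n) (x : Fin n) → x ∉ p → ∣ p ∪ ⁅ x ⁆ ∣ ≡ suc ∣ p ∣
∣p∪⁅x⁆∣ (false ∷ p) zero    _   = cong (suc ∘ ∣_∣) (∪-identityʳ p)
∣p∪⁅x⁆∣ (true  ∷ p) zero    x∉p = ⊥-elim (x∉p here)
∣p∪⁅x⁆∣ (false ∷ p) (suc x) x∉p = ∣p∪⁅x⁆∣ p x (x∉p ∘ there)
∣p∪⁅x⁆∣ (true  ∷ p) (suc x) x∉p = cong suc (∣p∪⁅x⁆∣ p x (x∉p ∘ there))

adj-distinct : ∀ (G : Graph) {u v} → Adj G u v → u ≢ v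
adj-distinct G {u} a refl with trans (sym (Graph.irrefl G u)) a
... | ()

module ForcedCore
  (H G : Graph)
  (F : Subset (Graph.n G))
  (x : Fin (Graph.n H) → Fin (Graph.n G))
  (x-injective : ∀ {i j} → x i ≡ x j → i ≡ j)
  (x∉F : ∀ i → x i ∉ F)
  (x-adj : ∀ i j → Adj H i j ⇔ Adj G (x i) (x j))
  (candidate-ltd : ∀ i → LocatingTotalDominating G (F ∪ ⁅ x i ⁆))
  (forced : ∀ T → LocatingTotalDominating G T → F ⊆ T × ∃[ j ] (x j ∈ T))
  where

  S : Fin (Graph.n H) → Subset (Graph.n G)
  S i = F ∪ ⁅ x i ⁆

  F⊆S : ∀ {i} → F ⊆ S i
  F⊆S = p⊆p∪q _

  x∈S : ∀ i → x i ∈ S i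
  x∈S i = x∈p∪q⁺ (inj₂ (x∈⁅x⁆ (x i)))

  ∈S⁻ : ∀ {i y} → y ∈ S i → y ∈ F ⊎ y ≡ x i
  ∈S⁻ {i} h = Sum.map₂ (x∈⁅y⁆⇒x≡y (x i)) (x∈p∪q⁻ F ⁅ x i ⁆ h)

  contains-candidate : ∀ T → LocatingTotalDominating G T → ∃[ j ] (S j ⊆ T)
  contains-candidate T ltd with forced T ltd
  ... | F⊆T , j , xⱼ∈T = j , Sⱼ⊆T
    where
    Sⱼ⊆T : S j ⊆ T
    Sⱼ⊆T h with ∈S⁻ h
    ... | inj₁ y∈F = F⊆T y∈F
    ... | inj₂ refl = xⱼ∈T

  ∣S∣ : ∀ i → ∣ S i ∣ ≡ suc ∣ F ∣
  ∣S∣ i = ∣p∪⁅x⁆∣ F (x i) (x∉F i)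

  S-minimum : ∀ i → MinLTD G (S i)
  S-minimum i = candidate-ltd i , smallest
    where
    smallest : ∀ T → LocatingTotalDominating G T → ∣ S i ∣ ≤ ∣ T ∣
    smallest T ltd with contains-candidate T ltd
    ... | j , Sⱼ⊆T = subst (_≤ ∣ T ∣) (trans (∣S∣ j) (sym (∣S∣ i))) (p⊆q⇒∣p∣≤∣q∣ Sⱼ⊆T)

  -- A minimum set contains a candidate of the same size, hence equals it.
  S-onto : ∀ T → MinLTD G T → ∃[ i ] (S i ≡ T)
  S-onto T (ltd , minimal) with contains-candidate T ltd
  ... | j , Sⱼ⊆T = j , ⊆-antisym Sⱼ⊆T T⊆Sⱼ
    where
    T⊆Sⱼ : T ⊆ S j
    T⊆Sⱼ {y} y∈T with y ∈? S j
    ... | yes y∈S = y∈S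
    ... | no  y∉S = ⊥-elim (<⇒≱ (p⊂q⇒∣p∣<∣q∣ (Sⱼ⊆T , y , y∈T , y∉S))
                                (minimal (S j) (candidate-ltd j)))

  S-injective : ∀ i j → S i ≡ S j → i ≡ j
  S-injective i j e with ∈S⁻ (subst (x i ∈_) e (x∈S i))
  ... | inj₁ xᵢ∈F = ⊥-elim (x∉F i xᵢ∈F)
  ... | inj₂ xᵢ≡xⱼ = x-injective xᵢ≡xⱼ

  exchange : ∀ i j → x i ≢ x j → S j ≡ (S i - x i) ∪ ⁅ x j ⁆
  exchange i j xᵢ≢xⱼ = ⊆-antisym ⊆-exchanged exchanged-⊆
    where
    ⊆-exchanged : S j ⊆ (S i - x i) ∪ ⁅ x j ⁆
    ⊆-exchanged h with ∈S⁻ h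
    ... | inj₁ y∈F  = x∈p∪q⁺ (inj₁ (x∈p∧x≢y⇒x∈p-y (F⊆S y∈F) (λ e → x∉F i (subst (_∈ F) e y∈F))))
    ... | inj₂ refl = x∈p∪q⁺ (inj₂ (x∈⁅x⁆ (x j)))
    exchanged-⊆ : (S i - x i) ∪ ⁅ x j ⁆ ⊆ S j
    exchanged-⊆ h with x∈p∪q⁻ (S i - x i) ⁅ x j ⁆ h
    ... | inj₂ y∈⁅xⱼ⁆ = subst (_∈ S j) (sym (x∈⁅y⁆⇒x≡y (x j) y∈⁅xⱼ⁆)) (x∈S j)
    ... | inj₁ y∈Sᵢ-xᵢ with ∈-minus y∈Sᵢ-xᵢ
    ... | y∈Sᵢ , y≢xᵢ with ∈S⁻ y∈Sᵢ
    ... | inj₁ y∈F  = F⊆S y∈F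
    ... | inj₂ y≡xᵢ = ⊥-elim (y≢xᵢ y≡xᵢ)

  move⁺ : ∀ i j → Adj G (x i) (x j) → GammaAdj G (S i) (S j)
  move⁺ i j a = x i , x j , x∈S i , x∈S j , a , exchange i j (adj-distinct G a)

  -- In a move S i → S j the vertex leaving must be x i and the one entering x j.
  move⁻ : ∀ i j → GammaAdj G (S i) (S j) → Adj G (x i) (x j)
  move⁻ i j (u , w , u∈Sᵢ , _ , a , Sⱼ≡) = adj-at u≡xᵢ w≡xⱼ
    where
    u∉Sⱼ : u ∉ S j
    u∉Sⱼ h with x∈p∪q⁻ (S i - u) ⁅ w ⁆ (subst (u ∈_) Sⱼ≡ h)
    ... | inj₁ u∈Sᵢ-u = x∉p-x (S i) u u∈Sᵢ-u
    ... | inj₂ u∈⁅w⁆  = adj-distinct G a (x∈⁅y⁆⇒x≡y w u∈⁅w⁆)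
    u≡xᵢ : u ≡ x i
    u≡xᵢ with ∈S⁻ u∈Sᵢ
    ... | inj₁ u∈F  = ⊥-elim (u∉Sⱼ (F⊆S u∈F))
    ... | inj₂ u≡xᵢ = u≡xᵢ
    w≡xⱼ : w ≡ x j
    w≡xⱼ with x∈p∪q⁻ (S i - u) ⁅ w ⁆ (subst (x j ∈_) Sⱼ≡ (x∈S j))
    ... | inj₂ xⱼ∈⁅w⁆ = sym (x∈⁅y⁆⇒x≡y w xⱼ∈⁅w⁆)
    ... | inj₁ xⱼ∈Sᵢ-u with ∈-minus xⱼ∈Sᵢ-u
    ... | xⱼ∈Sᵢ , xⱼ≢u with ∈S⁻ xⱼ∈Sᵢ
    ... | inj₁ xⱼ∈F  = ⊥-elim (x∉F j xⱼ∈F)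
    ... | inj₂ xⱼ≡xᵢ = ⊥-elim (xⱼ≢u (trans xⱼ≡xᵢ (sym u≡xᵢ)))
    adj-at : u ≡ x i → w ≡ x j → Adj G (x i) (x j)
    adj-at refl refl = a

  gammaGraph : IsGammaGraphOf H G
  gammaGraph = S , S-minimum , S-onto , S-injective
             , λ i j → mk⇔ (move⁺ i j ∘ to (x-adj i j)) (from (x-adj i j) ∘ move⁻ i j)

-- A graph presented on a type V of vertices with a coding V ≅ Fin n and an
-- orientation E of its edges; the lemmas translate the notions of Defs,
-- stated on codes, into statements about V.
module CodedGraph
  {V : Set} {n : ℕ}
  (enc : V → Fin n) (dec : Fin n → V)
  (dec∘enc : ∀ v → dec (enc v) ≡ v) (enc∘dec : ∀ p → enc (dec p) ≡ p)
  (E : V → V → Bool) (E-irreflexive : ∀ v → E v v ≡ false)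
  where

  A : V → V → Bool
  A u v = E u v ∨ E v u

  A-symmetric : ∀ u v → A u v ≡ A v u
  A-symmetric u v = ∨-comm (E u v) (E v u)

  graph : Graph
  graph = record
    { n      = n
    ; adj    = λ p q → A (dec p) (dec q)
    ; sym    = λ p q → A-symmetric (dec p) (dec q)
    ; irrefl = λ p → cong₂ _∨_ (E-irreflexive (dec p)) (E-irreflexive (dec p))
    }

  Nbhd : V → V → Set
  Nbhd u w = u ≡ w ⊎ A u w ≡ true

  by-codes : (P : Fin n → Set) → (∀ v → P (enc v)) → ∀ p → P p
  by-codes P h p = subst P (enc∘dec p) (h (dec p))

  enc-injective : ∀ {u v} → enc u ≡ enc v → u ≡ v
  enc-injective {u} {v} e = trans (sym (dec∘enc u)) (trans (cong dec e) (dec∘enc v))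

  adj-enc : ∀ u v → Graph.adj graph (enc u) (enc v) ≡ A u v
  adj-enc u v = cong₂ A (dec∘enc u) (dec∘enc v)

  nbhd⇔ : ∀ {u w} → InClosedNbhd graph (enc u) (enc w) ⇔ Nbhd u w
  nbhd⇔ {u} {w} = mk⇔ (Sum.map enc-injective (trans (sym (adj-enc u w))))
                      (Sum.map (cong enc) (trans (adj-enc u w)))

  total⇔ : ∀ {S} → Total graph S ⇔ (∀ u → ∃[ w ] (enc w ∈ S × A u w ≡ true))
  total⇔ {S} = mk⇔ on-V on-codes
    where
    on-V : Total graph S → ∀ u → ∃[ w ] (enc w ∈ S × A u w ≡ true)
    on-V t u with t (enc u)
    ... | p , p∈S , a = dec p , subst (_∈ S) (sym (enc∘dec p)) p∈S
                      , subst (λ v → A v (dec p) ≡ true) (dec∘enc u) a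
    on-codes : (∀ u → ∃[ w ] (enc w ∈ S × A u w ≡ true)) → Total graph S
    on-codes t = by-codes _ λ u → let (w , w∈S , a) = t u in
                   enc w , w∈S , trans (adj-enc u w) a

  TraceIncluded : Subset n → V → V → Set
  TraceIncluded S u v = ∀ w → enc w ∈ S → Nbhd u w → Nbhd v w

  locating-on-V : ∀ {S} →
    (∀ u v → enc u ∉ S → enc v ∉ S → TraceIncluded S u v → TraceIncluded S v u → u ≡ v) →
    Locating graph S
  locating-on-V {S} h = by-codes _ λ u → by-codes _ λ v u∉S v∉S same →
    cong enc (h u v u∉S v∉S (included λ p → to (same p)) (included λ p → from (same p)))
    where
    included : ∀ {u v} →
      (∀ p → p ∈ S × InClosedNbhd graph (enc u) p → p ∈ S × InClosedNbhd graph (enc v) p) →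
      TraceIncluded S u v
    included f w w∈S nb = to nbhd⇔ (proj₂ (f (enc w) (w∈S , from nbhd⇔ nb)))

  codesOf : (V → Bool) → Subset n
  codesOf P = tabulate (P ∘ dec)

  ∈codesOf⇔ : ∀ {P v} → enc v ∈ codesOf P ⇔ P v ≡ true
  ∈codesOf⇔ {P} {v} = mk⇔
    (λ h → trans (sym (value v)) ([]=⇒lookup h))
    (λ h → lookup⇒[]= (enc v) (codesOf P) (trans (value v) h))
    where
    value : ∀ v → lookup (codesOf P) (enc v) ≡ P v
    value v = trans (lookup∘tabulate (P ∘ dec) (enc v)) (cong P (dec∘enc v))

sameFin : ∀ {m} → Fin m → Fin m → Bool
sameFin zero    zero    = true
sameFin (suc a) (suc b) = sameFin a b
sameFin _       _       = false

sameFin-refl : ∀ {m} (a : Fin m) → sameFin a a ≡ true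
sameFin-refl zero    = refl
sameFin-refl (suc a) = sameFin-refl a

sameFin-sound : ∀ {m} (a b : Fin m) → sameFin a b ≡ true → a ≡ b
sameFin-sound zero    zero    _ = refl
sameFin-sound (suc a) (suc b) h = cong suc (sameFin-sound a b h)
sameFin-sound zero    (suc b) ()
sameFin-sound (suc a) zero    ()

pattern leafˡ    = zero
pattern supportˡ = suc zero
pattern supportʳ = suc (suc zero)
pattern leafʳ    = suc (suc (suc zero))

module Gadget (H : Graph) (N : ℕ) where

  k : ℕ
  k = Graph.n H

  -- Number of pendant paths: the first k carry the copy of H, the others pad.
  M : ℕ
  M = k + N

  data V : Set where
    hub  : V
    copy : Fin k → V
    path : Fin 4 → Fin M → V

  attach : Fin k → Fin M
  attach i = i ↑ˡ N

  E : V → V → Bool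
  E hub               (copy i)           = true
  E (copy i)          (copy j)           = Graph.adj H i j
  E (copy i)          (path supportˡ g)  = sameFin (attach i) g
  E (copy i)          (path supportʳ g)  = sameFin (attach i) g
  E (path leafˡ g)    (path supportˡ h)  = sameFin g h
  E (path supportˡ g) (path supportʳ h)  = sameFin g h
  E (path supportʳ g) (path leafʳ h)     = sameFin g h
  E _                 _                  = false

  E-irreflexive : ∀ v → E v v ≡ false
  E-irreflexive hub               = refl
  E-irreflexive (copy i)          = Graph.irrefl H i
  E-irreflexive (path leafˡ g)    = refl
  E-irreflexive (path supportˡ g) = refl
  E-irreflexive (path supportʳ g) = refl
  E-irreflexive (path leafʳ g)    = refl

  enc : V → Fin (suc (k + 4 * M))
  enc hub        = zero
  enc (copy i)   = suc (i ↑ˡ (4 * M))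
  enc (path r g) = suc (k ↑ʳ combine r g)

  decode-tail : Fin k ⊎ Fin (4 * M) → V
  decode-tail (inj₁ i) = copy i
  decode-tail (inj₂ q) = let (r , g) = remQuot {4} M q in path r g

  dec : Fin (suc (k + 4 * M)) → V
  dec zero    = hub
  dec (suc p) = decode-tail (splitAt k p)

  dec∘enc : ∀ v → dec (enc v) ≡ v
  dec∘enc hub        = refl
  dec∘enc (copy i)   = cong decode-tail (splitAt-↑ˡ k i (4 * M))
  dec∘enc (path r g) = trans (cong decode-tail (splitAt-↑ʳ k (4 * M) (combine r g)))
                             (cong (λ rg → path (proj₁ rg) (proj₂ rg)) (remQuot-combine {4} {M} r g))

  enc∘decode-tail : ∀ s → enc (decode-tail s) ≡ suc (join k (4 * M) s)
  enc∘decode-tail (inj₁ i) = refl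
  enc∘decode-tail (inj₂ q) = cong (λ c → suc (k ↑ʳ c)) (combine-remQuot {n = 4} M q)

  enc∘dec : ∀ p → enc (dec p) ≡ p
  enc∘dec zero    = refl
  enc∘dec (suc p) = trans (enc∘decode-tail (splitAt k p)) (cong suc (join-splitAt k (4 * M) p))

  open CodedGraph enc dec dec∘enc enc∘dec E E-irreflexive

  G : Graph
  G = graph

  large : N ≤ Graph.n G
  large = begin
    N                 ≤⟨ m≤n+m N k ⟩
    M                 ≤⟨ m≤n*m M 4 ⟩
    4 * M             ≤⟨ m≤n+m (4 * M) k ⟩
    k + 4 * M         ≤⟨ n≤1+n (k + 4 * M) ⟩
    suc (k + 4 * M)   ∎
    where open ≤-Reasoning

  -- The inner path vertices: the forced part of every total dominating set.
  isSupport : V → Bool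
  isSupport (path supportˡ g) = true
  isSupport (path supportʳ g) = true
  isSupport _                 = false

  F : Subset (Graph.n G)
  F = codesOf isSupport

  x : Fin k → Fin (Graph.n G)
  x i = enc (copy i)

  InS : Fin k → V → Set
  InS i v = isSupport v ≡ true ⊎ v ≡ copy i

  ∈S⇔ : ∀ {i v} → enc v ∈ F ∪ ⁅ x i ⁆ ⇔ InS i v
  ∈S⇔ {i} {v} = mk⇔ on-V on-codes
    where
    on-V : enc v ∈ F ∪ ⁅ x i ⁆ → InS i v
    on-V h with x∈p∪q⁻ F ⁅ x i ⁆ h
    ... | inj₁ v∈F  = inj₁ (to ∈codesOf⇔ v∈F)
    ... | inj₂ v∈xᵢ = inj₂ (enc-injective (x∈⁅y⁆⇒x≡y (x i) v∈xᵢ))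
    on-codes : InS i v → enc v ∈ F ∪ ⁅ x i ⁆
    on-codes (inj₁ support) = x∈p∪q⁺ (inj₁ (from ∈codesOf⇔ support))
    on-codes (inj₂ refl)    = x∈p∪q⁺ (inj₂ (x∈⁅x⁆ (x i)))

  copy~supportˡ : ∀ j → A (copy j) (path supportˡ (attach j)) ≡ true
  copy~supportˡ j = trans (∨-identityʳ _) (sameFin-refl (attach j))

  copy~supportʳ : ∀ j → A (copy j) (path supportʳ (attach j)) ≡ true
  copy~supportʳ j = trans (∨-identityʳ _) (sameFin-refl (attach j))

  leafˡ~supportˡ : ∀ g → A (path leafˡ g) (path supportˡ g) ≡ true
  leafˡ~supportˡ g = trans (∨-identityʳ _) (sameFin-refl g)

  supportˡ~supportʳ : ∀ g → A (path supportˡ g) (path supportʳ g) ≡ true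
  supportˡ~supportʳ g = trans (∨-identityʳ _) (sameFin-refl g)

  leafʳ~supportʳ : ∀ g → A (path leafʳ g) (path supportʳ g) ≡ true
  leafʳ~supportʳ g = sameFin-refl g

  leafˡ-neighbour : ∀ g v → A (path leafˡ g) v ≡ true → v ≡ path supportˡ g
  leafˡ-neighbour g (path supportˡ h) a =
    cong (path supportˡ) (sym (sameFin-sound g h (trans (sym (∨-identityʳ _)) a)))
  leafˡ-neighbour g hub               ()
  leafˡ-neighbour g (copy j)          ()
  leafˡ-neighbour g (path leafˡ h)    ()
  leafˡ-neighbour g (path supportʳ h) ()
  leafˡ-neighbour g (path leafʳ h)    ()

  leafʳ-neighbour : ∀ g v → A (path leafʳ g) v ≡ true → v ≡ path supportʳ g
  leafʳ-neighbour g (path supportʳ h) a = cong (path supportʳ) (sameFin-sound h g a)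
  leafʳ-neighbour g hub               ()
  leafʳ-neighbour g (copy j)          ()
  leafʳ-neighbour g (path leafˡ h)    ()
  leafʳ-neighbour g (path supportˡ h) ()
  leafʳ-neighbour g (path leafʳ h)    ()

  hub-neighbour : ∀ v → A hub v ≡ true → ∃[ j ] (v ≡ copy j)
  hub-neighbour (copy j)          _  = j , refl
  hub-neighbour hub               ()
  hub-neighbour (path leafˡ g)    ()
  hub-neighbour (path supportˡ g) ()
  hub-neighbour (path supportʳ g) ()
  hub-neighbour (path leafʳ g)    ()

  x-injective : ∀ {i j} → x i ≡ x j → i ≡ j
  x-injective {i} {j} e with enc-injective {copy i} {copy j} e
  ... | refl = refl

  x∉F : ∀ i → x i ∉ F
  x∉F i h with to (∈codesOf⇔ {isSupport} {copy i}) h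
  ... | ()

  x-adj : ∀ i j → Adj H i j ⇔ Adj G (x i) (x j)
  x-adj i j = mk⇔ (λ a → trans (adj-enc (copy i) (copy j)) (cong (_∨ Graph.adj H j i) a)) reflect
    where
    open ≡-Reasoning
    reflect : Adj G (x i) (x j) → Adj H i j
    reflect a = begin
      Graph.adj H i j                   ≡⟨ sym (∨-idem _) ⟩
      Graph.adj H i j ∨ Graph.adj H i j ≡⟨ cong (Graph.adj H i j ∨_) (Graph.sym H i j) ⟩
      A (copy i) (copy j)               ≡⟨ sym (adj-enc (copy i) (copy j)) ⟩
      Graph.adj G (x i) (x j)           ≡⟨ a ⟩
      true                              ∎

  dominated : ∀ i u → ∃[ w ] (InS i w × A u w ≡ true)
  dominated i hub               = copy i , inj₂ refl , refl
  dominated i (copy j)          = path supportˡ (attach j) , inj₁ refl , copy~supportˡ j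
  dominated i (path leafˡ g)    = path supportˡ g , inj₁ refl , leafˡ~supportˡ g
  dominated i (path supportˡ g) = path supportʳ g , inj₁ refl , supportˡ~supportʳ g
  dominated i (path supportʳ g) = path supportˡ g , inj₁ refl
                                , trans (A-symmetric (path supportʳ g) (path supportˡ g)) (supportˡ~supportʳ g)
  dominated i (path leafʳ g)    = path supportʳ g , inj₁ refl , leafʳ~supportʳ g

  candidate-total : ∀ i → Total G (F ∪ ⁅ x i ⁆)
  candidate-total i = from total⇔ λ u →
    let (w , w∈S , a) = dominated i u in w , from ∈S⇔ w∈S , a

  module Traces (i : Fin k) where

    Incl : V → V → Set
    Incl = TraceIncluded (F ∪ ⁅ x i ⁆)

    separates : ∀ {u v} w → InS i w → A u w ≡ true → A v w ≡ false → v ≢ w → ¬ Incl u v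
    separates w w∈S uw vw̸ v≢w incl with incl w (from ∈S⇔ w∈S) (inj₂ uw)
    ... | inj₁ v≡w = v≢w v≡w
    ... | inj₂ vw with trans (sym vw̸) vw
    ... | ()

    -- Copies, left leaves and right leaves are recognised by their supports.
    copy-attachment : ∀ j g → Nbhd (copy j) (path supportˡ g) → attach j ≡ g
    copy-attachment j g (inj₁ ())
    copy-attachment j g (inj₂ a) = sameFin-sound (attach j) g (trans (sym (∨-identityʳ _)) a)

    leafˡ-support : ∀ g h → Nbhd (path leafˡ h) (path supportˡ g) → g ≡ h
    leafˡ-support g h (inj₁ ())
    leafˡ-support g h (inj₂ a) with leafˡ-neighbour h (path supportˡ g) a
    ... | refl = refl

    leafʳ-support : ∀ g h → Nbhd (path leafʳ h) (path supportʳ g) → g ≡ h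
    leafʳ-support g h (inj₁ ())
    leafʳ-support g h (inj₂ a) with leafʳ-neighbour h (path supportʳ g) a
    ... | refl = refl

    supportˡ-in : ∀ g → enc (path supportˡ g) ∈ F ∪ ⁅ x i ⁆
    supportˡ-in g = from (∈S⇔ {i} {path supportˡ g}) (inj₁ refl)

    supportʳ-in : ∀ g → enc (path supportʳ g) ∈ F ∪ ⁅ x i ⁆
    supportʳ-in g = from (∈S⇔ {i} {path supportʳ g}) (inj₁ refl)

    pinned : ∀ u v → ¬ InS i u → ¬ InS i v → Incl u v → Incl v u → u ≡ v
    pinned (path supportˡ g) _ u∉S _ _ _ = ⊥-elim (u∉S (inj₁ refl))
    pinned (path supportʳ g) _ u∉S _ _ _ = ⊥-elim (u∉S (inj₁ refl))
    pinned _ (path supportˡ g) _ v∉S _ _ = ⊥-elim (v∉S (inj₁ refl))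
    pinned _ (path supportʳ g) _ v∉S _ _ = ⊥-elim (v∉S (inj₁ refl))
    pinned hub hub _ _ _ _ = refl
    pinned (copy j) (copy j') _ _ u⊆v _ =
      cong copy (↑ˡ-injective N j j'
        (sym (copy-attachment j' (attach j) (u⊆v _ (supportˡ-in _) (inj₂ (copy~supportˡ j))))))
    pinned (path leafˡ g) (path leafˡ h) _ _ u⊆v _ =
      cong (path leafˡ) (leafˡ-support g h (u⊆v _ (supportˡ-in g) (inj₂ (leafˡ~supportˡ g))))
    pinned (path leafʳ g) (path leafʳ h) _ _ u⊆v _ =
      cong (path leafʳ) (leafʳ-support g h (u⊆v _ (supportʳ-in g) (inj₂ (leafʳ~supportʳ g))))
    pinned hub (copy j) _ _ _ v⊆u =
      ⊥-elim (separates (path supportˡ (attach j)) (inj₁ refl) (copy~supportˡ j) refl (λ ()) v⊆u)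
    pinned (copy j) hub _ _ u⊆v _ =
      ⊥-elim (separates (path supportˡ (attach j)) (inj₁ refl) (copy~supportˡ j) refl (λ ()) u⊆v)
    pinned hub (path leafˡ g) _ _ _ v⊆u =
      ⊥-elim (separates (path supportˡ g) (inj₁ refl) (leafˡ~supportˡ g) refl (λ ()) v⊆u)
    pinned (path leafˡ g) hub _ _ u⊆v _ =
      ⊥-elim (separates (path supportˡ g) (inj₁ refl) (leafˡ~supportˡ g) refl (λ ()) u⊆v)
    pinned hub (path leafʳ g) _ _ _ v⊆u =
      ⊥-elim (separates (path supportʳ g) (inj₁ refl) (leafʳ~supportʳ g) refl (λ ()) v⊆u)
    pinned (path leafʳ g) hub _ _ u⊆v _ =
      ⊥-elim (separates (path supportʳ g) (inj₁ refl) (leafʳ~supportʳ g) refl (λ ()) u⊆v)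
    pinned (copy j) (path leafˡ g) _ _ u⊆v _ =
      ⊥-elim (separates (path supportʳ (attach j)) (inj₁ refl) (copy~supportʳ j) refl (λ ()) u⊆v)
    pinned (path leafˡ g) (copy j) _ _ _ v⊆u =
      ⊥-elim (separates (path supportʳ (attach j)) (inj₁ refl) (copy~supportʳ j) refl (λ ()) v⊆u)
    pinned (copy j) (path leafʳ g) _ _ u⊆v _ =
      ⊥-elim (separates (path supportˡ (attach j)) (inj₁ refl) (copy~supportˡ j) refl (λ ()) u⊆v)
    pinned (path leafʳ g) (copy j) _ _ _ v⊆u =
      ⊥-elim (separates (path supportˡ (attach j)) (inj₁ refl) (copy~supportˡ j) refl (λ ()) v⊆u)
    pinned (path leafˡ g) (path leafʳ h) _ _ u⊆v _ =
      ⊥-elim (separates (path supportˡ g) (inj₁ refl) (leafˡ~supportˡ g) refl (λ ()) u⊆v)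
    pinned (path leafʳ h) (path leafˡ g) _ _ _ v⊆u =
      ⊥-elim (separates (path supportˡ g) (inj₁ refl) (leafˡ~supportˡ g) refl (λ ()) v⊆u)

  candidate-locating : ∀ i → Locating G (F ∪ ⁅ x i ⁆)
  candidate-locating i = locating-on-V λ u v u∉S v∉S →
    Traces.pinned i u v (u∉S ∘ from ∈S⇔) (v∉S ∘ from ∈S⇔)

  candidate-ltd : ∀ i → LocatingTotalDominating G (F ∪ ⁅ x i ⁆)
  candidate-ltd i = ((λ v _ → candidate-total i v) , candidate-locating i) , candidate-total i

  -- Totality alone forces the supports (neighbours of leaves) and a copy
  -- (a neighbour of the hub) into every locating-total dominating set.
  forced : ∀ T → LocatingTotalDominating G T → F ⊆ T × ∃[ j ] (x j ∈ T)
  forced T (_ , total) = F⊆T , copy∈T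
    where
    neighbour-in-T : ∀ u → ∃[ w ] (enc w ∈ T × A u w ≡ true)
    neighbour-in-T = to total⇔ total
    support∈T : ∀ v → isSupport v ≡ true → enc v ∈ T
    support∈T (path supportˡ g) _ with neighbour-in-T (path leafˡ g)
    ... | w , w∈T , a = subst (λ v → enc v ∈ T) (leafˡ-neighbour g w a) w∈T
    support∈T (path supportʳ g) _ with neighbour-in-T (path leafʳ g)
    ... | w , w∈T , a = subst (λ v → enc v ∈ T) (leafʳ-neighbour g w a) w∈T
    support∈T hub            ()
    support∈T (copy j)       ()
    support∈T (path leafˡ g) ()
    support∈T (path leafʳ g) ()
    F⊆T : F ⊆ T
    F⊆T {p} = by-codes (λ p → p ∈ F → p ∈ T) (λ v v∈F → support∈T v (to ∈codesOf⇔ v∈F)) p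
    copy∈T : ∃[ j ] (x j ∈ T)
    copy∈T with neighbour-in-T hub
    ... | w , w∈T , a with hub-neighbour w a
    ... | j , refl = j , w∈T

  realises : IsGammaGraphOf H G
  realises = ForcedCore.gammaGraph H G F x x-injective x∉F x-adj candidate-ltd forced

corollary8 : ∀ (H : Graph) (N : ℕ) →
    ∃[ G ] (N ≤ Graph.n G × IsGammaGraphOf H G)
corollary8 H N = G , large , realises
  where open Gadget H N
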